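{- Let $C$ be a finite set of SNF clauses such that the temporal resolution procedure (described in the context) applied to $C$ returns "unsat", let $G$ be the resolution graph of this run, and let $G'$ be the smallest subgraph of $G$ containing the vertex $v_\Box$ of the main partition labeled with the empty clause and all vertices backward reachable from $v_\Box$ (with the corresponding edges). Let $v$ be a vertex of $G'$ labeled with a clause $\mathbf{G}(\neg w_l\vee\mathbf{X}(l\vee w_l))$ created by rule aug2 from some eventuality clause $\mathbf{G}(p_1\vee\dots\vee p_n\vee\mathbf{F}l)\in C$ with eventuality literal $l$. Then there is a vertex $v'$ in $G'$ labeled with an eventuality clause $\mathbf{G}(q_1\vee\dots\vee q_{n'}\vee\mathbf{F}l)\in C$ with eventuality literal $l$.
   Context: LTL over infinite sequences of valuations of a finite set $AP$ of atomic propositions, with operators $\neg,\vee,\wedge,\mathbf{X},\mathbf{F},\mathbf{G}$. A literal is $p$ or $\neg p$, $p\in AP$. $P,Q,R,S$ denote (possibly empty) disjunctions of pairwise different literals, $l$ a literal; empty disjunctions are $0$. SNF clauses: initial clauses $P$; global clauses $\mathbf{G}(P\vee\mathbf{X}Q)$ ($\mathbf{X}$ part $Q$; written $\mathbf{G}(P)$ if empty); eventuality clauses $\mathbf{G}(P\vee\mathbf{F}l)$ with eventuality literal $l$. Empty clause $\Box$: $0$ or $\mathbf{G}(0)$. For each eventuality literal $l$, $w_l$ is a fresh proposition not occurring in $C$. Production rules (partition of conclusion; edges from premises to conclusion): init-ii: initial $P\vee l$, initial $\neg l\vee Q$ $\Rightarrow$ initial $P\vee Q$ ($M$; both); init-in: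 initial $P\vee l$, $\mathbf{G}(\neg l\vee Q)$ $\Rightarrow$ initial $P\vee Q$ ($M$; both); step-nn: $\mathbf{G}(P\vee l)$, $\mathbf{G}(\neg l\vee Q)$ $\Rightarrow$ $\mathbf{G}(P\vee Q)$ ($M$; both); step-nx: $\mathbf{G}(P\vee l)$, $\mathbf{G}(Q\vee\mathbf{X}(\neg l\vee R))$ $\Rightarrow$ $\mathbf{G}(Q\vee\mathbf{X}(P\vee R))$ ($M$; both); step-xx: $\mathbf{G}(P\vee\mathbf{X}(Q\vee l))$, $\mathbf{G}(R\vee\mathbf{X}(\neg l\vee S))$ $\Rightarrow$ $\mathbf{G}(P\vee R\vee\mathbf{X}(Q\vee S))$ (all in $M$ or all in current loop partition $L$; both); aug1: $\mathbf{G}(P\vee\mathbf{F}l)$ $\Rightarrow$ $\mathbf{G}(P\vee l\vee w_l)$ ($M$; edge); aug2: $\mathbf{G}(P\vee\mathbf{F}l)$ $\Rightarrow$ $\mathbf{G}(\neg w_l\vee\mathbf{X}(l\vee w_l))$ ($M$; no edge); loop-it-init-x: global $c=\mathbf{G}(P\vee\mathbf{X}Q)$ in $M$, $Q$ nonempty $\Rightarrow$ copy of $c$ ($L$; edge); loop-it-init-n: $\mathbf{G}(P)$ in $M$ $\Rightarrow$ $\mathbf{G}(\mathbf{X}P)$ ($L$; edge); loop-it-init-c: $\mathbf{G}(P)$ from previous loop partition (or $\Box$), eventuality $\mathbf{G}(Q\vee\mathbf{F}l)$ in $M$ $\Rightarrow$ $\mathbf{G}(\mathbf{X}(P\vee l))$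 ($L$; new vertex, no edges); loop-it-sub: $c=\mathbf{G}(P)$ in $L$ implying $\mathbf{G}(Q)$, and $\mathbf{G}(\mathbf{X}(Q\vee l))$ in $L$ generated by loop-it-init-c $\Rightarrow$ no new vertex, edge from $c$'s vertex to that of $\mathbf{G}(\mathbf{X}(Q\vee l))$; loop-conc1: $\mathbf{G}(P)$ in $L$, $\mathbf{G}(Q\vee\mathbf{F}l)$ in $M$ $\Rightarrow$ $\mathbf{G}(P\vee Q\vee l)$ ($M$; both); loop-conc2: same premises $\Rightarrow$ $\mathbf{G}(\neg w_l\vee\mathbf{X}(P\vee l))$ ($M$; edge from $\mathbf{G}(P)$ only). Procedure: $M:=C$; if $\Box\in M$ return unsat. Saturate $M$ with init-ii, init-in, step-nn, step-nx, step-xx (until no new clauses); if $\Box\in M$ return unsat. Apply aug1 to each eventuality clause and aug2 once per eventuality literal; saturate; if $\Box\in M$ return unsat. $M':=\emptyset$; while $M'\neq M$: $M':=M$; for each eventuality clause $c\in C$ with literal $l$: $C':=\{\Box\}$; repeat: new loop partition $L$ initialized by loop-it-init-x on each global clause of $M$ with nonempty $\mathbf{X}$ part, loop-it-init-n on each global clause of $M$ with empty $\mathbf{X}$ part, loop-it-init-c on each clause of $C'$ with $c$; saturate $L$ with step-xx only; $C':=$ clauses of $L$ with empty $\mathbf{X}$ part; $C'':=\{\mathbf{G}(Q)\mid\mathbf{G}(\mathbf{X}(Q\vee l))\in L$ from loop-it-init-c$\}$; found $:=$ each clause in $C''$ is subsumed by some clause of $C'$ (recorded as loop-it-sub); until found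 or $C'=\emptyset$; if found: apply loop-conc1 and loop-conc2 to each clause of $C'$ with $c$, saturate $M$, return unsat if $\Box\in M$. Return sat. Resolution graph $G$: vertices labeled with clauses, partitioned into a main partition and one partition per loop search iteration; initially one main-partition vertex per clause of $C$, no edges; for each rule application generating a new clause (or first loop-it-sub application to a clause of $C''$), a new vertex is created when the rule creates one, and edges are added as annotated above. -}

module Defs where

open import Data.Nat using (ℕ; zero; suc; _≡ᵇ_)
open import Data.Fin using (Fin)
open import Data.Bool using (Bool; true; false; not; if_then_else_)
open import Data.List using (List; []; _∷_; _++_; [_]; map; length)
open import Data.List.Membership.Propositional using (_∈_)
open import Data.List.Relation.Unary.All using (All)
open import Data.List.Relation.Unary.Unique.Propositional using (Unique)
open import Data.Product using (Σ; ∃; _×_; _,_; proj₂)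
open import Data.Sum using (_⊎_)
open import Data.Maybe using (Maybe; just; nothing)
open import Data.Empty using (⊥)
open import Data.Unit using (⊤)
open import Relation.Nullary using (¬_)
open import Relation.Binary.PropositionalEquality using (_≡_; _≢_)
open import Relation.Binary.Construct.Closure.ReflexiveTransitive using (Star)

-- AP = Fin n.  Extended propositions: the atoms of AP and, for every
-- AP-literal l = (b , a)  (b = true: positive), the fresh proposition w_l.
data Var (n : ℕ) : Set where
  ap : Fin n → Var n
  w  : Bool → Fin n → Var n

-- a literal: polarity (true = positive) and a proposition
data Lit (n : ℕ) : Set where
  lit : Bool → Var n → Lit n

neg : ∀ {n} → Lit n → Lit n
neg (lit b x) = lit (not b) x

ALit : ℕ → Set
ALit n = Bool × Fin n

⌜_⌝ : ∀ {n} → ALit n → Lit n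
⌜ b , a ⌝ = lit b (ap a)

wL : ∀ {n} → ALit n → Lit n
wL (b , a) = lit true (w b a)

-- a disjunction of literals, read as the set of its literals
Disj : ℕ → Set
Disj n = List (Lit n)

data Clause (n : ℕ) : Set where
  init : Disj n → Clause n
  glob : Disj n → Disj n → Clause n        -- G(P ∨ X Q)   (G(P) when Q = [])
  ev   : Disj n → ALit n → Clause n        -- G(P ∨ F l)

Iff : Set → Set → Set
Iff A B = (A → B) × (B → A)

_≋_ : ∀ {n} → Disj n → Disj n → Set
A ≋ B = ∀ x → Iff (x ∈ A) (x ∈ B)

_≈_ : ∀ {n} → Clause n → Clause n → Set
init A ≈ init B = A ≋ B
glob A X ≈ glob B Y = A ≋ B × X ≋ Y
ev A l ≈ ev B m = A ≋ B × l ≡ m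
_ ≈ _ = ⊥

IsBox : ∀ {n} → Clause n → Set
IsBox (init P) = P ≡ []
IsBox (glob P Q) = P ≡ [] × Q ≡ []
IsBox (ev _ _) = ⊥

WFreeL : ∀ {n} → Lit n → Set
WFreeL (lit _ (ap _)) = ⊤
WFreeL (lit _ (w _ _)) = ⊥

WFree : ∀ {n} → Clause n → Set
WFree (init P) = All WFreeL P
WFree (glob P Q) = All WFreeL P × All WFreeL Q
WFree (ev P _) = All WFreeL P

data Rule : Set where
  inC init-ii init-in step-nn step-nx step-xx aug1 aug2
    lit-x lit-n lit-c conc1 conc2 : Rule

-- main partition, or the partition of the k-th loop search iteration
data Part : Set where
  main : Part
  loop : ℕ → Part

record Vertex (n : ℕ) : Set where
  constructor vx
  field
    label : Clause n
    part  : Part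
    rule  : Rule          -- rule that created the vertex (inC: clause of C)
open Vertex public

-- vertices are numbered 0,1,2,... in order of creation;
-- an edge (u , v) goes from vertex u to vertex v
record St (n : ℕ) : Set where
  constructor st
  field
    V  : List (Vertex n)
    E  : List (ℕ × ℕ)
    nl : ℕ                -- number of loop partitions created so far
open St public

data At {A : Set} : List A → ℕ → A → Set where
  here  : ∀ {x xs} → At (x ∷ xs) zero x
  there : ∀ {x xs i y} → At xs i y → At (x ∷ xs) (suc i) y

addV : ∀ {n} → St n → Vertex n → List ℕ → St n
addV (st V E k) v ps = st (V ++ [ v ]) (E ++ map (λ p → (p , length V)) ps) k

addE : ∀ {n} → St n → List (ℕ × ℕ) → St n
addE (st V E k) Es = st V (E ++ Es) k

InP : ∀ {n} → St n → Part → ℕ → Clause n → Set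
InP s p i c = Σ (Vertex _) λ v → At (V s) i v × part v ≡ p × label v ≡ c

HasP : ∀ {n} → St n → Part → Clause n → Set
HasP s p c = ∃ λ i → ∃ λ c′ → InP s p i c′ × c′ ≈ c

InM : ∀ {n} → St n → Clause n → Set
InM s c = HasP s main c

HasBox : ∀ {n} → St n → Set
HasBox s = ∃ λ i → ∃ λ c → InP s main i c × IsBox c

Resolvent : ∀ {n} → Disj n → Lit n → Disj n → Disj n → Set
Resolvent A l B R =
  l ∈ A × neg l ∈ B ×
  (∀ x → Iff (x ∈ R) ((x ∈ A × x ≢ l) ⊎ (x ∈ B × x ≢ neg l)))

Union : ∀ {n} → Disj n → Disj n → Disj n → Set
Union A B U = ∀ x → Iff (x ∈ U) (x ∈ A ⊎ x ∈ B)

data BRule {n : ℕ} : Rule → Clause n → Clause n → Clause n → Set where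
  r-ii : ∀ {A l B R} → Resolvent A l B R →
         BRule init-ii (init A) (init B) (init R)
  r-in : ∀ {A l B R} → Resolvent A l B R →
         BRule init-in (init A) (glob B []) (init R)
  r-nn : ∀ {A l B R} → Resolvent A l B R →
         BRule step-nn (glob A []) (glob B []) (glob R [])
  r-nx : ∀ {A l B R Q} → Resolvent A l B R →
         BRule step-nx (glob A []) (glob Q B) (glob Q R)
  r-xx : ∀ {P Q U A l B R} → Union P Q U → Resolvent A l B R →
         BRule step-xx (glob P A) (glob Q B) (glob U R)

data MStep {n : ℕ} (s : St n) : St n → Set where
  mstep : ∀ {r i j c₁ c₂ c} → InP s main i c₁ → InP s main j c₂ →
          BRule r c₁ c₂ c → ¬ InM s c →
          MStep s (addV s (vx c main r) (i ∷ j ∷ []))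

SatM : ∀ {n} → St n → Set
SatM s = ∀ {r i j c₁ c₂ c} → InP s main i c₁ → InP s main j c₂ →
         BRule r c₁ c₂ c → InM s c

Saturate : ∀ {n} → St n → St n → Set
Saturate s s′ = Star MStep s s′ × SatM s′

aug1C : ∀ {n} → Disj n → ALit n → Clause n
aug1C P l = glob (⌜ l ⌝ ∷ wL l ∷ P) []

aug2C : ∀ {n} → ALit n → Clause n
aug2C l = glob (neg (wL l) ∷ []) (⌜ l ⌝ ∷ wL l ∷ [])

data AStep {n : ℕ} (s : St n) : St n → Set where
  a1 : ∀ {k P l} → InP s main k (ev P l) → ¬ InM s (aug1C P l) →
       AStep s (addV s (vx (aug1C P l) main aug1) (k ∷ []))
  a2 : ∀ {k P l} → InP s main k (ev P l) → ¬ InM s (aug2C l) →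
       AStep s (addV s (vx (aug2C l) main aug2) [])

AugDone : ∀ {n} → St n → Set
AugDone s = ∀ {k P l} → InP s main k (ev P l) →
            InM s (aug1C P l) × InM s (aug2C l)

-- loop-it-init-x / loop-it-init-n for one vertex (index i) of M
initOne : ∀ {n} → ℕ → ℕ → Vertex n → St n → St n
initOne k i (vx (glob P []) main r) s =
  addV s (vx (glob [] P) (loop k) lit-n) (i ∷ [])
initOne k i (vx (glob P (q ∷ Q)) main r) s =
  addV s (vx (glob P (q ∷ Q)) (loop k) lit-x) (i ∷ [])
initOne k i (vx (init _) _ _) s = s
initOne k i (vx (ev _ _) _ _) s = s
initOne k i (vx (glob _ _) (loop _) _) s = s

initM : ∀ {n} → ℕ → ℕ → List (Vertex n) → St n → St n
initM k i [] s = s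
initM k i (v ∷ vs) s = initM k (suc i) vs (initOne k i v s)

-- loop-it-init-c:  G(P) ↦ G(X(P ∨ l)), new vertex, no edges
initC : ∀ {n} → ℕ → ALit n → List (Disj n) → St n → St n
initC k l [] s = s
initC k l (P ∷ Ps) s =
  initC k l Ps (addV s (vx (glob [] (⌜ l ⌝ ∷ P)) (loop k) lit-c) [])

-- initialise the new loop partition (number nl s), C′ given as now-parts
initL : ∀ {n} → St n → ALit n → List (Disj n) → St n
initL s l Cs = initC (nl s) l Cs (initM (nl s) 0 (V s) (st (V s) (E s) (suc (nl s))))

data LStep {n : ℕ} (k : ℕ) (s : St n) : St n → Set where
  lstep : ∀ {i j c₁ c₂ c} → InP s (loop k) i c₁ → InP s (loop k) j c₂ →
          BRule step-xx c₁ c₂ c → ¬ HasP s (loop k) c →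
          LStep k s (addV s (vx c (loop k) step-xx) (i ∷ j ∷ []))

SatL : ∀ {n} → ℕ → St n → Set
SatL k s = ∀ {i j c₁ c₂ c} → InP s (loop k) i c₁ → InP s (loop k) j c₂ →
           BRule step-xx c₁ c₂ c → HasP s (loop k) c

-- C′: now-parts of the clauses of loop partition k with empty X part
cpOne : ∀ {n} → ℕ → Vertex n → List (Disj n) → List (Disj n)
cpOne k (vx (glob P []) (loop m) r) rest = if m ≡ᵇ k then P ∷ rest else rest
cpOne k (vx (glob P (_ ∷ _)) _ _) rest = rest
cpOne k (vx (glob P []) main _) rest = rest
cpOne k (vx (init _) _ _) rest = rest
cpOne k (vx (ev _ _) _ _) rest = rest

cprime : ∀ {n} → ℕ → List (Vertex n) → List (Disj n)
cprime k [] = []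
cprime k (v ∷ vs) = cpOne k v (cprime k vs)

LitC : ∀ {n} → St n → ℕ → ℕ → Disj n → Set
LitC s k j Xs = Σ (Vertex _) λ v → At (V s) j v × part v ≡ loop k ×
                rule v ≡ lit-c × label v ≡ glob [] Xs

-- vertex i (G(P) ∈ C′) subsumes the C″-clause G(Q) of vertex j = G(X(Q ∨ l)),
-- i.e. P ⊆ Q = Xs \ {l}
Subsumes : ∀ {n} → St n → ℕ → ALit n → ℕ → ℕ → Set
Subsumes s k l i j = ∃ λ P → ∃ λ Xs → InP s (loop k) i (glob P []) × LitC s k j Xs ×
                     (∀ x → x ∈ P → x ∈ Xs × x ≢ ⌜ l ⌝)

Found : ∀ {n} → St n → ℕ → ALit n → Set
Found s k l = ∀ j Xs → LitC s k j Xs → ∃ λ i → Subsumes s k l i j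

-- loop-it-sub edges: exactly one edge (from a subsuming vertex) into every
-- subsumed loop-it-init-c vertex
SubEdges : ∀ {n} → St n → ℕ → ALit n → List (ℕ × ℕ) → Set
SubEdges s k l Es =
  All (λ e → Subsumes s k l (Data.Product.proj₁ e) (proj₂ e)) Es ×
  Unique (map proj₂ Es) ×
  (∀ i j → Subsumes s k l i j → j ∈ map proj₂ Es)

-- Search l s C′ s′ r : loop search for eventuality literal l starting in
-- state s with current C′; ends in s′; r = just k if found in partition k
data Search {n : ℕ} (l : ALit n) : St n → List (Disj n) → St n → Maybe ℕ → Set where
  found : ∀ {s Cs s₂ Es} →
    Star (LStep (nl s)) (initL s l Cs) s₂ → SatL (nl s) s₂ →
    SubEdges s₂ (nl s) l Es → Found s₂ (nl s) l →
    Search l s Cs (addE s₂ Es) (just (nl s))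
  empty : ∀ {s Cs s₂ Es} →
    Star (LStep (nl s)) (initL s l Cs) s₂ → SatL (nl s) s₂ →
    SubEdges s₂ (nl s) l Es → ¬ Found s₂ (nl s) l →
    cprime (nl s) (V s₂) ≡ [] →
    Search l s Cs (addE s₂ Es) nothing
  again : ∀ {s Cs s₂ Es s₃ r} →
    Star (LStep (nl s)) (initL s l Cs) s₂ → SatL (nl s) s₂ →
    SubEdges s₂ (nl s) l Es → ¬ Found s₂ (nl s) l →
    cprime (nl s) (V s₂) ≢ [] →
    Search l (addE s₂ Es) (cprime (nl s) (V s₂)) s₃ r →
    Search l s Cs s₃ r

conc1C : ∀ {n} → Disj n → Disj n → ALit n → Clause n
conc1C P Q l = glob (P ++ Q ++ (⌜ l ⌝ ∷ [])) []

conc2C : ∀ {n} → Disj n → ALit n → Clause n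
conc2C P l = glob (neg (wL l) ∷ []) (P ++ (⌜ l ⌝ ∷ []))

-- eventuality clause c = G(Q ∨ F l) at main vertex kc, loop partition k
data CStep {n : ℕ} (kc : ℕ) (Q : Disj n) (l : ALit n) (k : ℕ) (s : St n) : St n → Set where
  c1 : ∀ {i P} → InP s (loop k) i (glob P []) → ¬ InM s (conc1C P Q l) →
       CStep kc Q l k s (addV s (vx (conc1C P Q l) main conc1) (i ∷ kc ∷ []))
  c2 : ∀ {i P} → InP s (loop k) i (glob P []) → ¬ InM s (conc2C P l) →
       CStep kc Q l k s (addV s (vx (conc2C P l) main conc2) (i ∷ []))

ConcDone : ∀ {n} → Disj n → ALit n → ℕ → St n → Set
ConcDone Q l k s = ∀ {i P} → InP s (loop k) i (glob P []) →
                   InM s (conc1C P Q l) × InM s (conc2C P l)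

data Outcome (n : ℕ) : Set where
  unsat : St n → Outcome n
  fin   : St n → Outcome n

evOne : ∀ {n} → ℕ → Clause n → List (ℕ × Disj n × ALit n) → List (ℕ × Disj n × ALit n)
evOne k (ev P l) rest = (k , P , l) ∷ rest
evOne k (init _) rest = rest
evOne k (glob _ _) rest = rest

evs : ∀ {n} → ℕ → List (Clause n) → List (ℕ × Disj n × ALit n)
evs k [] = []
evs k (c ∷ cs) = evOne k c (evs (suc k) cs)

-- one pass of the "for each eventuality clause" loop
data ForEv {n : ℕ} : List (ℕ × Disj n × ALit n) → St n → Outcome n → Set where
  nil : ∀ {s} → ForEv [] s (fin s)
  notfound : ∀ {kc Q l es s s₁ r} →
    Search l s ([] ∷ []) s₁ nothing → ForEv es s₁ r →
    ForEv ((kc , Q , l) ∷ es) s r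
  found-unsat : ∀ {kc Q l es s s₁ k s₂ s₃} →
    Search l s ([] ∷ []) s₁ (just k) →
    Star (CStep kc Q l k) s₁ s₂ → ConcDone Q l k s₂ →
    Saturate s₂ s₃ → HasBox s₃ →
    ForEv ((kc , Q , l) ∷ es) s (unsat s₃)
  found-cont : ∀ {kc Q l es s s₁ k s₂ s₃ r} →
    Search l s ([] ∷ []) s₁ (just k) →
    Star (CStep kc Q l k) s₁ s₂ → ConcDone Q l k s₂ →
    Saturate s₂ s₃ → ¬ HasBox s₃ → ForEv es s₃ r →
    ForEv ((kc , Q , l) ∷ es) s r

MGrew : ∀ {n} → St n → St n → Set
MGrew s s′ = ∃ λ c → InM s′ c × ¬ InM s c

-- while M′ ≠ M loop, ending with "unsat" in the given final state
data Outer {n : ℕ} (es : List (ℕ × Disj n × ALit n)) : St n → St n → Set where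
  stop : ∀ {s s′} → ForEv es s (unsat s′) → Outer es s s′
  more : ∀ {s s₂ s′} → ForEv es s (fin s₂) → MGrew s s₂ → Outer es s₂ s′ → Outer es s s′

st0 : ∀ {n} → List (Clause n) → St n
st0 C = st (map (λ c → vx c main inC) C) [] 0

-- RunUnsat C s : a run of the procedure on C returns "unsat",
-- s being the final state (its vertices and edges form the resolution graph)
data RunUnsat {n : ℕ} (C : List (Clause n)) : St n → Set where
  r0 : HasBox (st0 C) → RunUnsat C (st0 C)
  r1 : ∀ {s₁} → ¬ HasBox (st0 C) → Saturate (st0 C) s₁ → HasBox s₁ → RunUnsat C s₁
  r2 : ∀ {s₁ s₂ s₃} → ¬ HasBox (st0 C) → Saturate (st0 C) s₁ → ¬ HasBox s₁ →
       Star AStep s₁ s₂ → AugDone s₂ → Saturate s₂ s₃ → HasBox s₃ → RunUnsat C s₃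
  r3 : ∀ {s₁ s₂ s₃ s₄} → ¬ HasBox (st0 C) → Saturate (st0 C) s₁ → ¬ HasBox s₁ →
       Star AStep s₁ s₂ → AugDone s₂ → Saturate s₂ s₃ → ¬ HasBox s₃ →
       Outer (evs 0 C) s₃ s₄ → RunUnsat C s₄

data Reaches (Es : List (ℕ × ℕ)) : ℕ → ℕ → Set where
  done : ∀ {u} → Reaches Es u u
  step : ∀ {u m v} → (u , m) ∈ Es → Reaches Es m v → Reaches Es u v

module Submission where

-- Fix the eventuality literal l and call a vertex grounded if some vertex
-- labelled with an eventuality clause G(Q ∨ F l) of C reaches it.  The
-- literal ¬w_l can only be resolved away against a clause containing w_l, and
-- a clause containing w_l in its present part is grounded: C is w-free, so
-- w_l enters the main partition only through aug1 (an edge from the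
-- eventuality clause) and never reaches the present part of a loop clause.
-- A clause containing w_l only in its X part (aug2, loop-conc2 and their
-- descendants) still carries ¬w_l in its present part, unless it is grounded.
-- Hence every vertex on a path leaving the aug2 vertex contains ¬w_l or is
-- grounded; the empty clause contains nothing, so it is grounded.

open import Defs
open import Data.Nat using (ℕ; suc; _+_; _≡ᵇ_)
open import Data.Nat.Properties using (+-suc; +-identityʳ)
open import Data.Bool using (true; false)
import Data.Bool.Properties as Bool
import Data.Fin.Properties as Fin
open import Data.List using (List; []; _∷_; _++_; map; length)
open import Data.List.Membership.Propositional using (_∈_)
open import Data.List.Membership.Propositional.Properties using (∈-++⁺ˡ; ∈-++⁺ʳ; ∈-++⁻; ∈-map⁺; ∈-map⁻)
open import Data.List.Relation.Unary.Any using (here; there)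
open import Data.List.Relation.Unary.All as All using (All; []; _∷_)
open import Data.List.Relation.Unary.AllPairs using (AllPairs)
open import Data.Product using (∃; _×_; _,_; proj₁; proj₂; map₂)
open import Data.Sum as Sum using (_⊎_; inj₁; inj₂; [_,_])
open import Data.Maybe using (just)
open import Data.Empty using (⊥; ⊥-elim)
open import Data.Unit using (⊤; tt)
open import Function using (id; _∘_)
open import Relation.Nullary using (¬_; Dec; yes; no)
open import Relation.Binary.PropositionalEquality using (_≡_; refl; sym; cong; subst; _≢_)
open import Relation.Binary.Construct.Closure.ReflexiveTransitive using (Star; ε; _◅_)

At-functional : ∀ {A : Set} {xs : List A} {i a b} → At xs i a → At xs i b → a ≡ b
At-functional here      here      = refl
At-functional (there p) (there q) = At-functional p q

At-++⁺ˡ : ∀ {A : Set} {xs ys : List A} {i a} → At xs i a → At (xs ++ ys) i a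
At-++⁺ˡ here      = here
At-++⁺ˡ (there p) = there (At-++⁺ˡ p)

At-∷ʳ : ∀ {A : Set} (xs : List A) {y} → At (xs ++ y ∷ []) (length xs) y
At-∷ʳ []       = here
At-∷ʳ (x ∷ xs) = there (At-∷ʳ xs)

At-∷ʳ⁻ : ∀ {A : Set} (xs : List A) {y i a} → At (xs ++ y ∷ []) i a →
         At xs i a ⊎ (i ≡ length xs × a ≡ y)
At-∷ʳ⁻ []       here      = inj₂ (refl , refl)
At-∷ʳ⁻ []       (there ())
At-∷ʳ⁻ (x ∷ xs) here      = inj₁ here
At-∷ʳ⁻ (x ∷ xs) (there p) with At-∷ʳ⁻ xs p
... | inj₁ q             = inj₁ (there q)
... | inj₂ (refl , refl) = inj₂ (refl , refl)

At-map⁺ : ∀ {A B : Set} (f : A → B) {xs i a} → At xs i a → At (map f xs) i (f a)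
At-map⁺ f here      = here
At-map⁺ f (there p) = there (At-map⁺ f p)

At-map⁻ : ∀ {A B : Set} (f : A → B) {xs i b} → At (map f xs) i b → ∃ λ a → a ∈ xs × b ≡ f a
At-map⁻ f {x ∷ xs} here      = x , here refl , refl
At-map⁻ f {x ∷ xs} (there p) with At-map⁻ f p
... | a , a∈xs , refl = a , there a∈xs , refl

Segment : ∀ {A B : Set} → (A → B) → List B → ℕ → List A → Set
Segment f xs i ys = ∀ {m y} → At ys m y → At xs (i + m) (f y)

Segment-head : ∀ {A B : Set} {f : A → B} {xs i y ys} → Segment f xs i (y ∷ ys) → At xs i (f y)
Segment-head {f = f} {xs} {i} {y} seg = subst (λ j → At xs j (f y)) (+-identityʳ i) (seg here)

Segment-tail : ∀ {A B : Set} {f : A → B} {xs i y ys} → Segment f xs i (y ∷ ys) → Segment f xs (suc i) ys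
Segment-tail {f = f} {xs} {i} seg {m} {y} a = subst (λ j → At xs j (f y)) (+-suc i m) (seg (there a))

Reaches-mono : ∀ {E E′ : List (ℕ × ℕ)} → (∀ {e} → e ∈ E → e ∈ E′) →
               ∀ {u v} → Reaches E u v → Reaches E′ u v
Reaches-mono E⊆E′ done       = done
Reaches-mono E⊆E′ (step e r) = step (E⊆E′ e) (Reaches-mono E⊆E′ r)

Reaches-∷ʳ : ∀ {E u m v} → Reaches E u m → (m , v) ∈ E → Reaches E u v
Reaches-∷ʳ done       e′ = step e′ done
Reaches-∷ʳ (step e r) e′ = step e (Reaches-∷ʳ r e′)

module _ {n : ℕ} where

  _≟ᵛ_ : (x y : Var n) → Dec (x ≡ y)
  ap a ≟ᵛ ap b with a Fin.≟ b
  ... | yes refl = yes refl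
  ... | no a≢b   = no λ { refl → a≢b refl }
  ap _ ≟ᵛ w _ _ = no λ ()
  w _ _ ≟ᵛ ap _ = no λ ()
  w b a ≟ᵛ w c d with b Bool.≟ c | a Fin.≟ d
  ... | yes refl | yes refl = yes refl
  ... | no b≢c   | _        = no λ { refl → b≢c refl }
  ... | yes _    | no a≢d   = no λ { refl → a≢d refl }

  _≟ˡ_ : (x y : Lit n) → Dec (x ≡ y)
  lit b x ≟ˡ lit c y with b Bool.≟ c | x ≟ᵛ y
  ... | yes refl | yes refl = yes refl
  ... | no b≢c   | _        = no λ { refl → b≢c refl }
  ... | yes _    | no x≢y   = no λ { refl → x≢y refl }

  neg-involutive : (x : Lit n) → neg (neg x) ≡ x
  neg-involutive (lit b x) = cong (λ b′ → lit b′ x) (Bool.not-involutive b)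

  wL-injective : ∀ {l l′ : ALit n} → wL l ≡ wL l′ → l ≡ l′
  wL-injective refl = refl

  Resolvent-∈ˡ : ∀ {A B R : Disj n} {l x : Lit n} → Resolvent A l B R → x ∈ A → x ≢ l → x ∈ R
  Resolvent-∈ˡ {x = x} (_ , _ , R↔) x∈A x≢l = proj₂ (R↔ x) (inj₁ (x∈A , x≢l))

  Resolvent-∈ʳ : ∀ {A B R : Disj n} {l x : Lit n} → Resolvent A l B R → x ∈ B → x ≢ neg l → x ∈ R
  Resolvent-∈ʳ {x = x} (_ , _ , R↔) x∈B x≢¬l = proj₂ (R↔ x) (inj₂ (x∈B , x≢¬l))

  Resolvent-∈⁻ : ∀ {A B R : Disj n} {l x : Lit n} → Resolvent A l B R → x ∈ R → x ∈ A ⊎ x ∈ B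
  Resolvent-∈⁻ {x = x} (_ , _ , R↔) x∈R = Sum.map proj₁ proj₁ (proj₁ (R↔ x) x∈R)

  Union-∈⁻ : ∀ {A B U : Disj n} {x} → Union A B U → x ∈ U → x ∈ A ⊎ x ∈ B
  Union-∈⁻ {x = x} U↔ = proj₁ (U↔ x)

  Union-∈ˡ : ∀ {A B U : Disj n} {x} → Union A B U → x ∈ A → x ∈ U
  Union-∈ˡ {x = x} U↔ = proj₂ (U↔ x) ∘ inj₁

  Union-∈ʳ : ∀ {A B U : Disj n} {x} → Union A B U → x ∈ B → x ∈ U
  Union-∈ʳ {x = x} U↔ = proj₂ (U↔ x) ∘ inj₂

  Resolvent-survivesˡ : ∀ {A B R : Disj n} {l x : Lit n} → Resolvent A l B R → x ∈ A → x ∈ R ⊎ neg x ∈ B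
  Resolvent-survivesˡ {l = l} {x = x} res@(_ , ¬l∈B , _) x∈A with x ≟ˡ l
  ... | yes refl = inj₂ ¬l∈B
  ... | no x≢l   = inj₁ (Resolvent-∈ˡ res x∈A x≢l)

  Resolvent-survivesʳ : ∀ {A B R : Disj n} {l x : Lit n} → Resolvent A l B R → x ∈ B → x ∈ R ⊎ neg x ∈ A
  Resolvent-survivesʳ {A = A} {l = l} {x = x} res@(l∈A , _ , _) x∈B with x ≟ˡ neg l
  ... | yes refl = inj₂ (subst (_∈ A) (sym (neg-involutive l)) l∈A)
  ... | no x≢¬l  = inj₁ (Resolvent-∈ʳ res x∈B x≢¬l)

module Tracing {n : ℕ} (C : List (Clause n)) (C-wfree : All WFree C) (l : ALit n) where

  w⁺ w⁻ : Lit n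
  w⁺ = wL l
  w⁻ = neg w⁺

  ¬w⁻∈⇒w⁺∈ : ∀ {A : Disj n} → neg w⁻ ∈ A → w⁺ ∈ A
  ¬w⁻∈⇒w⁺∈ {A} = subst (_∈ A) (neg-involutive w⁺)

  now next : Clause n → Disj n
  now (init P)   = P
  now (glob P _) = P
  now (ev P _)   = P
  next (init _)   = []
  next (glob _ Q) = Q
  next (ev _ _)   = []

  data Grounded (s : St n) (u : ℕ) : Set where
    grounded : ∀ j vj Q → At (V s) j vj → Reaches (E s) j u →
               label vj ≡ ev Q l → ev Q l ∈ C → Grounded s u

  Marked : Clause n → Set
  Marked c = w⁻ ∈ now c ⊎ w⁻ ∈ next c

  data Traced (s : St n) (x : ℕ) : Set where
    grounded-vertex : Grounded s x → Traced s x
    marked-vertex   : ∀ {v} → At (V s) x v → Marked (label v) → Traced s x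

  -- loop-it-init-c moves the present parts of loop clauses into X parts of new
  -- vertices without edges, so these must be free of w_l; main clauses with a
  -- nonempty X part are copied into loop partitions.
  CopiedToLoop : Part → Disj n → Set
  CopiedToLoop main     []      = ⊥
  CopiedToLoop main     (_ ∷ _) = ⊤
  CopiedToLoop (loop _) _       = ⊤

  W⁺Free : Disj n → Set
  W⁺Free P = ¬ w⁺ ∈ P

  NowW⁺Free : Part → Clause n → Set
  NowW⁺Free p c = ∀ {P A} → c ≡ glob P A → CopiedToLoop p A → W⁺Free P

  EvFromC : Clause n → Set
  EvFromC c = ∀ {P l′} → c ≡ ev P l′ → ev P l′ ∈ C

  record Justified (Z : Set) (c : Clause n) : Set where
    field
      w⁺-now  : w⁺ ∈ now c → Z
      w⁺-next : w⁺ ∈ next c → w⁻ ∈ now c ⊎ Z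
  open Justified

  Justified-map : ∀ {Z Z′ c} → (Z → Z′) → Justified Z c → Justified Z′ c
  Justified-map f J = record { w⁺-now = f ∘ w⁺-now J ; w⁺-next = Sum.map id f ∘ w⁺-next J }

  Justified-w⁺-free : ∀ {Z c} → All WFreeL (now c) → All WFreeL (next c) → Justified Z c
  Justified-w⁺-free now-free next-free =
    record { w⁺-now = ⊥-elim ∘ All.lookup now-free ; w⁺-next = ⊥-elim ∘ All.lookup next-free }

  record VertexInv (s : St n) (k : ℕ) (v : Vertex n) : Set where
    constructor vertex-inv
    field
      ev∈C        : EvFromC (label v)
      now-w⁺-free : NowW⁺Free (part v) (label v)
      justified   : Justified (Grounded s k) (label v)
  open VertexInv

  data Passes (s s′ : St n) (u x : ℕ) : Set where
    via : ∀ {vu} → At (V s) u vu → (Marked (label vu) → Traced s′ x) → Passes s s′ u x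

  record Invariant (s : St n) : Set where
    field
      vertex : ∀ {k v} → At (V s) k v → VertexInv s k v
      edge   : ∀ {u x} → (u , x) ∈ E s → Passes s s u x
  open Invariant

  record _⊑_ (s s′ : St n) : Set where
    constructor extends
    field
      ⊑-At : ∀ {i v} → At (V s) i v → At (V s′) i v
      ⊑-E  : ∀ {e} → e ∈ E s → e ∈ E s′
  open _⊑_

  ⊑-refl : ∀ {s} → s ⊑ s
  ⊑-refl = extends id id

  ⊑-trans : ∀ {s₁ s₂ s₃} → s₁ ⊑ s₂ → s₂ ⊑ s₃ → s₁ ⊑ s₃
  ⊑-trans X Y = extends (⊑-At Y ∘ ⊑-At X) (⊑-E Y ∘ ⊑-E X)

  Grounded-mono : ∀ {s s′ u} → s ⊑ s′ → Grounded s u → Grounded s′ u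
  Grounded-mono X (grounded j vj Q a r lab ev∈) = grounded j vj Q (⊑-At X a) (Reaches-mono (⊑-E X) r) lab ev∈

  Grounded-step : ∀ {s u x} → (u , x) ∈ E s → Grounded s u → Grounded s x
  Grounded-step e (grounded j vj Q a r lab ev∈) = grounded j vj Q a (Reaches-∷ʳ r e) lab ev∈

  Traced-mono : ∀ {s s′ x} → s ⊑ s′ → Traced s x → Traced s′ x
  Traced-mono X (grounded-vertex g) = grounded-vertex (Grounded-mono X g)
  Traced-mono X (marked-vertex a m) = marked-vertex (⊑-At X a) m

  VertexInv-mono : ∀ {s s′ k v} → s ⊑ s′ → VertexInv s k v → VertexInv s′ k v
  VertexInv-mono X (vertex-inv e∈C w⁺-free J) = vertex-inv e∈C w⁺-free (Justified-map (Grounded-mono X) J)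

  Passes-source : ∀ {s s′ s″ u x} → s ⊑ s′ → Passes s s″ u x → Passes s′ s″ u x
  Passes-source X (via a pass) = via (⊑-At X a) pass

  Passes-target : ∀ {s s′ s″ u x} → s′ ⊑ s″ → Passes s s′ u x → Passes s s″ u x
  Passes-target X (via a pass) = via a (Traced-mono X ∘ pass)

  Preserves : St n → St n → Set
  Preserves s s′ = Invariant s′ × s ⊑ s′

  Preserving : (St n → St n → Set) → Set
  Preserving R = ∀ {s s′} → Invariant s → R s s′ → Preserves s s′

  infixr 1 _▷_
  _▷_ : ∀ {s₁ s₂ s₃} → Preserves s₁ s₂ → (Invariant s₂ → s₁ ⊑ s₂ → Preserves s₂ s₃) → Preserves s₁ s₃
  (I , X) ▷ k = map₂ (⊑-trans X) (k I X)

  Star-preserving : ∀ {R} → Preserving R → Preserving (Star R)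
  Star-preserving p I ε        = I , ⊑-refl
  Star-preserving p I (r ◅ rs) = p I r ▷ λ I′ _ → Star-preserving p I′ rs

  new : St n → ℕ
  new s = length (V s)

  addV-⊑ : ∀ s v ps → s ⊑ addV s v ps
  addV-⊑ s v ps = extends At-++⁺ˡ ∈-++⁺ˡ

  addV-grounded : ∀ s v {ps p} → p ∈ ps → Grounded s p → Grounded (addV s v ps) (new s)
  addV-grounded s v {ps} p∈ps =
    Grounded-step (∈-++⁺ʳ (E s) (∈-map⁺ (λ p → (p , new s)) p∈ps)) ∘ Grounded-mono (addV-⊑ s v ps)

  addV-marked : ∀ s v ps → Marked (label v) → Traced (addV s v ps) (new s)
  addV-marked s v ps = marked-vertex (At-∷ʳ (V s))

  addV-preserves : ∀ s v ps → Invariant s → VertexInv (addV s v ps) (new s) v →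
                   (∀ {p} → p ∈ ps → Passes s (addV s v ps) p (new s)) → Preserves s (addV s v ps)
  addV-preserves s v ps I v-inv incoming = record { vertex = vertex′ ; edge = edge′ } , X
    where
    X = addV-⊑ s v ps
    vertex′ : ∀ {k u} → At (V (addV s v ps)) k u → VertexInv (addV s v ps) k u
    vertex′ a with At-∷ʳ⁻ (V s) a
    ... | inj₁ a′           = VertexInv-mono X (vertex I a′)
    ... | inj₂ (refl , refl) = v-inv
    edge′ : ∀ {u x} → (u , x) ∈ E (addV s v ps) → Passes (addV s v ps) (addV s v ps) u x
    edge′ e with ∈-++⁻ (E s) e
    ... | inj₁ e′ = Passes-source X (Passes-target X (edge I e′))
    ... | inj₂ e′ with ∈-map⁻ (λ p → (p , new s)) e′
    ...   | _ , p∈ps , refl = Passes-source X (incoming p∈ps)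

  addE-preserves : ∀ s Es → Invariant s → (∀ {u x} → (u , x) ∈ Es → Passes s (addE s Es) u x) →
                   Preserves s (addE s Es)
  addE-preserves s Es I incoming = record { vertex = vertex′ ; edge = edge′ } , X
    where
    X : s ⊑ addE s Es
    X = extends id ∈-++⁺ˡ
    vertex′ : ∀ {k v} → At (V s) k v → VertexInv (addE s Es) k v
    vertex′ = VertexInv-mono X ∘ vertex I
    edge′ : ∀ {u x} → (u , x) ∈ E (addE s Es) → Passes (addE s Es) (addE s Es) u x
    edge′ e with ∈-++⁻ (E s) e
    ... | inj₁ e′ = Passes-source X (Passes-target X (edge I e′))
    ... | inj₂ e′ = Passes-source X (incoming e′)

  w⁻-survivesˡ : ∀ {Z : Set} {A B R : Disj n} {p} → Resolvent A p B R → (w⁺ ∈ B → Z) → w⁻ ∈ A → w⁻ ∈ R ⊎ Z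
  w⁻-survivesˡ res f = Sum.map id (f ∘ ¬w⁻∈⇒w⁺∈) ∘ Resolvent-survivesˡ res

  w⁻-survivesʳ : ∀ {Z : Set} {A B R : Disj n} {p} → Resolvent A p B R → (w⁺ ∈ A → Z) → w⁻ ∈ B → w⁻ ∈ R ⊎ Z
  w⁻-survivesʳ res f = Sum.map id (f ∘ ¬w⁻∈⇒w⁺∈) ∘ Resolvent-survivesʳ res

  module _ {Z : Set} where

    Justified-resolvent-now : ∀ {r} {c₁ c₂ c : Clause n} → BRule r c₁ c₂ c →
                              Justified Z c₁ → Justified Z c₂ → w⁺ ∈ now c → Z
    Justified-resolvent-now (r-ii res)   J₁ J₂ = [ w⁺-now J₁ , w⁺-now J₂ ] ∘ Resolvent-∈⁻ res
    Justified-resolvent-now (r-in res)   J₁ J₂ = [ w⁺-now J₁ , w⁺-now J₂ ] ∘ Resolvent-∈⁻ res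
    Justified-resolvent-now (r-nn res)   J₁ J₂ = [ w⁺-now J₁ , w⁺-now J₂ ] ∘ Resolvent-∈⁻ res
    Justified-resolvent-now (r-nx res)   J₁ J₂ = w⁺-now J₂
    Justified-resolvent-now (r-xx U res) J₁ J₂ = [ w⁺-now J₁ , w⁺-now J₂ ] ∘ Union-∈⁻ U

    Justified-resolvent-next : ∀ {r} {c₁ c₂ c : Clause n} → BRule r c₁ c₂ c →
                               Justified Z c₁ → Justified Z c₂ → w⁺ ∈ next c → w⁻ ∈ now c ⊎ Z
    Justified-resolvent-next (r-ii _)     J₁ J₂ ()
    Justified-resolvent-next (r-in _)     J₁ J₂ ()
    Justified-resolvent-next (r-nn _)     J₁ J₂ ()
    Justified-resolvent-next (r-nx res)   J₁ J₂ = [ inj₂ ∘ w⁺-now J₁ , w⁺-next J₂ ] ∘ Resolvent-∈⁻ res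
    Justified-resolvent-next (r-xx U res) J₁ J₂ =
      [ Sum.map (Union-∈ˡ U) id ∘ w⁺-next J₁ , Sum.map (Union-∈ʳ U) id ∘ w⁺-next J₂ ] ∘ Resolvent-∈⁻ res

    Justified-resolvent : ∀ {r} {c₁ c₂ c : Clause n} → BRule r c₁ c₂ c →
                          Justified Z c₁ → Justified Z c₂ → Justified Z c
    Justified-resolvent br J₁ J₂ =
      record { w⁺-now = Justified-resolvent-now br J₁ J₂ ; w⁺-next = Justified-resolvent-next br J₁ J₂ }

    Marked-resolventˡ : ∀ {r} {c₁ c₂ c : Clause n} → BRule r c₁ c₂ c →
                        Justified Z c₂ → Marked c₁ → Marked c ⊎ Z
    Marked-resolventˡ (r-ii res)   J₂ (inj₁ m) = Sum.map inj₁ id (w⁻-survivesˡ res (w⁺-now J₂) m)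
    Marked-resolventˡ (r-ii res)   J₂ (inj₂ ())
    Marked-resolventˡ (r-in res)   J₂ (inj₁ m) = Sum.map inj₁ id (w⁻-survivesˡ res (w⁺-now J₂) m)
    Marked-resolventˡ (r-in res)   J₂ (inj₂ ())
    Marked-resolventˡ (r-nn res)   J₂ (inj₁ m) = Sum.map inj₁ id (w⁻-survivesˡ res (w⁺-now J₂) m)
    Marked-resolventˡ (r-nn res)   J₂ (inj₂ ())
    Marked-resolventˡ (r-nx res)   J₂ (inj₁ m) =
      [ inj₁ ∘ inj₂ , Sum.map inj₁ id ] (w⁻-survivesˡ res (w⁺-next J₂) m)
    Marked-resolventˡ (r-nx res)   J₂ (inj₂ ())
    Marked-resolventˡ (r-xx U res) J₂ (inj₁ m) = inj₁ (inj₁ (Union-∈ˡ U m))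
    Marked-resolventˡ (r-xx U res) J₂ (inj₂ m) =
      [ inj₁ ∘ inj₂ , Sum.map (inj₁ ∘ Union-∈ʳ U) id ] (w⁻-survivesˡ res (w⁺-next J₂) m)

    Marked-resolventʳ : ∀ {r} {c₁ c₂ c : Clause n} → BRule r c₁ c₂ c →
                        Justified Z c₁ → Marked c₂ → Marked c ⊎ Z
    Marked-resolventʳ (r-ii res)   J₁ (inj₁ m) = Sum.map inj₁ id (w⁻-survivesʳ res (w⁺-now J₁) m)
    Marked-resolventʳ (r-ii res)   J₁ (inj₂ ())
    Marked-resolventʳ (r-in res)   J₁ (inj₁ m) = Sum.map inj₁ id (w⁻-survivesʳ res (w⁺-now J₁) m)
    Marked-resolventʳ (r-in res)   J₁ (inj₂ ())
    Marked-resolventʳ (r-nn res)   J₁ (inj₁ m) = Sum.map inj₁ id (w⁻-survivesʳ res (w⁺-now J₁) m)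
    Marked-resolventʳ (r-nn res)   J₁ (inj₂ ())
    Marked-resolventʳ (r-nx res)   J₁ (inj₁ m) = inj₁ (inj₁ m)
    Marked-resolventʳ (r-nx res)   J₁ (inj₂ m) = Sum.map inj₂ id (w⁻-survivesʳ res (w⁺-now J₁) m)
    Marked-resolventʳ (r-xx U res) J₁ (inj₁ m) = inj₁ (inj₁ (Union-∈ʳ U m))
    Marked-resolventʳ (r-xx U res) J₁ (inj₂ m) =
      [ inj₁ ∘ inj₂ , Sum.map (inj₁ ∘ Union-∈ˡ U) id ] (w⁻-survivesʳ res (w⁺-next J₁) m)

  CopiedToLoop-∈ : ∀ {x : Lit n} {A} → x ∈ A → CopiedToLoop main A
  CopiedToLoop-∈ (here _)  = tt
  CopiedToLoop-∈ (there _) = tt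

  NowW⁺Free-resolvent-main : ∀ {r} {c₁ c₂ c : Clause n} → BRule r c₁ c₂ c →
                             NowW⁺Free main c₁ → NowW⁺Free main c₂ → NowW⁺Free main c
  NowW⁺Free-resolvent-main (r-ii _)     F₁ F₂ ()
  NowW⁺Free-resolvent-main (r-in _)     F₁ F₂ ()
  NowW⁺Free-resolvent-main (r-nn _)     F₁ F₂ refl ()
  NowW⁺Free-resolvent-main (r-nx res)   F₁ F₂ refl _ = F₂ refl (CopiedToLoop-∈ (proj₁ (proj₂ res)))
  NowW⁺Free-resolvent-main (r-xx U res) F₁ F₂ refl _ =
    [ F₁ refl (CopiedToLoop-∈ (proj₁ res)) , F₂ refl (CopiedToLoop-∈ (proj₁ (proj₂ res))) ] ∘ Union-∈⁻ U

  NowW⁺Free-resolvent-loop : ∀ {k} {c₁ c₂ c : Clause n} → BRule step-xx c₁ c₂ c →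
                             NowW⁺Free (loop k) c₁ → NowW⁺Free (loop k) c₂ → NowW⁺Free (loop k) c
  NowW⁺Free-resolvent-loop (r-xx U res) F₁ F₂ refl _ = [ F₁ refl tt , F₂ refl tt ] ∘ Union-∈⁻ U

  EvFromC-resolvent : ∀ {r} {c₁ c₂ c : Clause n} → BRule r c₁ c₂ c → EvFromC c
  EvFromC-resolvent (r-ii _)   ()
  EvFromC-resolvent (r-in _)   ()
  EvFromC-resolvent (r-nn _)   ()
  EvFromC-resolvent (r-nx _)   ()
  EvFromC-resolvent (r-xx _ _) ()

  resolution-preserves : ∀ s {i j v₁ v₂ r c p} → Invariant s → At (V s) i v₁ → At (V s) j v₂ →
                         BRule r (label v₁) (label v₂) c → NowW⁺Free p c →
                         Preserves s (addV s (vx c p r) (i ∷ j ∷ []))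
  resolution-preserves s {i} {j} {v₁} {v₂} {r} {c} {p} I a₁ a₂ br c-free =
    addV-preserves s v ps I (vertex-inv (EvFromC-resolvent br) c-free (Justified-resolvent br J₁ J₂)) incoming
    where
    v = vx c p r
    ps = i ∷ j ∷ []
    s′ = addV s v ps
    J₁ : Justified (Grounded s′ (new s)) (label v₁)
    J₁ = Justified-map (addV-grounded s v (here refl)) (justified (vertex I a₁))
    J₂ : Justified (Grounded s′ (new s)) (label v₂)
    J₂ = Justified-map (addV-grounded s v (there (here refl))) (justified (vertex I a₂))
    traced : Marked c ⊎ Grounded s′ (new s) → Traced s′ (new s)
    traced = [ addV-marked s v ps , grounded-vertex ]
    incoming : ∀ {q} → q ∈ ps → Passes s s′ q (new s)
    incoming (here refl)         = via a₁ (traced ∘ Marked-resolventˡ br J₂)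
    incoming (there (here refl)) = via a₂ (traced ∘ Marked-resolventʳ br J₁)

  mstep-preserves : Preserving MStep
  mstep-preserves {s} I (mstep (vx _ _ _ , a₁ , refl , refl) (vx _ _ _ , a₂ , refl , refl) br _) =
    resolution-preserves s I a₁ a₂ br
      (NowW⁺Free-resolvent-main br (now-w⁺-free (vertex I a₁)) (now-w⁺-free (vertex I a₂)))

  lstep-preserves : ∀ {k} → Preserving (LStep k)
  lstep-preserves {k} {s} I (lstep (vx _ _ _ , a₁ , refl , refl) (vx _ _ _ , a₂ , refl , refl) br _) =
    resolution-preserves s I a₁ a₂ br
      (NowW⁺Free-resolvent-loop {k} br (now-w⁺-free (vertex I a₁)) (now-w⁺-free (vertex I a₂)))

  Invariant-resp : ∀ {s s′} → s ⊑ s′ → s′ ⊑ s → Invariant s → Invariant s′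
  Invariant-resp X X′ I = record
    { vertex = VertexInv-mono X ∘ vertex I ∘ ⊑-At X′
    ; edge   = Passes-source X ∘ Passes-target X ∘ edge I ∘ ⊑-E X′
    }

  Grounded-eventuality : ∀ {s k v P l′} → Invariant s → At (V s) k v → label v ≡ ev P l′ → l ≡ l′ → Grounded s k
  Grounded-eventuality {P = P} I a lab refl = grounded _ _ P a done lab (ev∈C (vertex I a) lab)

  NowW⁺Free-wfree : ∀ {p} c → All WFreeL (now c) → NowW⁺Free p c
  NowW⁺Free-wfree c now-free refl _ = All.lookup now-free

  w⁺∉⌜_⌝ : ∀ l′ → ¬ w⁺ ∈ ⌜ l′ ⌝ ∷ []
  w⁺∉⌜ l′ ⌝ (here ())
  w⁺∉⌜ l′ ⌝ (there ())

  initOne-preserves : ∀ k i (v : Vertex n) s → Invariant s → At (V s) i v → Preserves s (initOne k i v s)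
  initOne-preserves k i (vx (glob P []) main _) s I a₀ =
    addV-preserves s v′ (i ∷ []) I (vertex-inv (λ ()) (λ { refl _ () }) J) incoming
    where
    v′ = vx (glob [] P) (loop k) lit-n
    J : Justified (Grounded (addV s v′ (i ∷ [])) (new s)) (glob [] P)
    J = record { w⁺-now  = λ ()
               ; w⁺-next = inj₂ ∘ addV-grounded s v′ (here refl) ∘ w⁺-now (justified (vertex I a₀)) }
    incoming : ∀ {q} → q ∈ i ∷ [] → Passes s (addV s v′ (i ∷ [])) q (new s)
    incoming (here refl) = via a₀ λ { (inj₁ m) → addV-marked s v′ (i ∷ []) (inj₂ m) ; (inj₂ ()) }
  initOne-preserves k i (vx (glob P (q ∷ Q)) main _) s I a₀ =
    addV-preserves s v′ (i ∷ []) I (vertex-inv (λ ()) (λ { refl _ → now-w⁺-free (vertex I a₀) refl tt }) J) incoming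
    where
    v′ = vx (glob P (q ∷ Q)) (loop k) lit-x
    J : Justified (Grounded (addV s v′ (i ∷ [])) (new s)) (glob P (q ∷ Q))
    J = Justified-map (addV-grounded s v′ (here refl)) (justified (vertex I a₀))
    incoming : ∀ {q} → q ∈ i ∷ [] → Passes s (addV s v′ (i ∷ [])) q (new s)
    incoming (here refl) = via a₀ (addV-marked s v′ (i ∷ []))
  initOne-preserves k i (vx (init _) _ _)                s I _ = I , ⊑-refl
  initOne-preserves k i (vx (ev _ _) _ _)                s I _ = I , ⊑-refl
  initOne-preserves k i (vx (glob _ []) (loop _) _)      s I _ = I , ⊑-refl
  initOne-preserves k i (vx (glob _ (_ ∷ _)) (loop _) _) s I _ = I , ⊑-refl

  initM-preserves : ∀ k i (vs : List (Vertex n)) s → Invariant s → Segment id (V s) i vs → Preserves s (initM k i vs s)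
  initM-preserves k i []       s I seg = I , ⊑-refl
  initM-preserves k i (v ∷ vs) s I seg =
    initOne-preserves k i v s I (Segment-head seg) ▷ λ I₁ X₁ →
    initM-preserves k (suc i) vs _ I₁ (⊑-At X₁ ∘ Segment-tail seg)

  initC-preserves : ∀ k l′ (Cs : List (Disj n)) s → Invariant s → All W⁺Free Cs → Preserves s (initC k l′ Cs s)
  initC-preserves k l′ []       s I _ = I , ⊑-refl
  initC-preserves k l′ (P ∷ Cs) s I (P-free ∷ Cs-free) =
    addV-preserves s v′ [] I (vertex-inv (λ ()) (λ { refl _ () }) J) (λ ()) ▷ λ I₁ _ →
    initC-preserves k l′ Cs _ I₁ Cs-free
    where
    v′ = vx (glob [] (⌜ l′ ⌝ ∷ P)) (loop k) lit-c
    J : Justified (Grounded (addV s v′ []) (new s)) (label v′)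
    J = record { w⁺-now = λ () ; w⁺-next = λ { (here ()) ; (there m) → ⊥-elim (P-free m) } }

  initL-preserves : ∀ s l′ Cs → Invariant s → All W⁺Free Cs → Preserves s (initL s l′ Cs)
  initL-preserves s l′ Cs I Cs-free =
    (Invariant-resp fresh-partition (extends id id) I , fresh-partition) ▷ λ I₀ _ →
    initM-preserves (nl s) 0 (V s) _ I₀ id ▷ λ I₁ _ →
    initC-preserves (nl s) l′ Cs _ I₁ Cs-free
    where
    fresh-partition : s ⊑ st (V s) (E s) (suc (nl s))
    fresh-partition = extends id id

  subEdges-preserves : ∀ s {k l′ Es} → Invariant s → SubEdges s k l′ Es → Preserves s (addE s Es)
  subEdges-preserves s {Es = Es} I (subsumes , _ , _) = addE-preserves s Es I incoming
    where
    incoming : ∀ {u x} → (u , x) ∈ Es → Passes s (addE s Es) u x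
    incoming e with All.lookup subsumes e
    ... | _ , _ , (vx _ _ _ , aᵢ , _ , refl) , (vx _ _ _ , aⱼ , _ , _ , refl) , P⊆Q =
      via aᵢ λ { (inj₁ m) → marked-vertex aⱼ (inj₂ (proj₁ (P⊆Q w⁻ m))) ; (inj₂ ()) }

  cprime-w⁺-free : ∀ k (vs : List (Vertex n)) → (∀ {m v} → At vs m v → NowW⁺Free (part v) (label v)) →
                   All W⁺Free (cprime k vs)
  cprime-w⁺-free k [] F = []
  cprime-w⁺-free k (vx (glob P []) (loop m) _ ∷ vs) F with m ≡ᵇ k
  ... | true  = F here refl tt ∷ cprime-w⁺-free k vs (F ∘ there)
  ... | false = cprime-w⁺-free k vs (F ∘ there)
  cprime-w⁺-free k (vx (glob _ (_ ∷ _)) _ _ ∷ vs) F = cprime-w⁺-free k vs (F ∘ there)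
  cprime-w⁺-free k (vx (glob _ []) main _ ∷ vs)   F = cprime-w⁺-free k vs (F ∘ there)
  cprime-w⁺-free k (vx (init _) _ _ ∷ vs)         F = cprime-w⁺-free k vs (F ∘ there)
  cprime-w⁺-free k (vx (ev _ _) _ _ ∷ vs)         F = cprime-w⁺-free k vs (F ∘ there)

  iteration-preserves : ∀ {l′ s Cs s₂ Es} → Invariant s → All W⁺Free Cs →
                        Star (LStep (nl s)) (initL s l′ Cs) s₂ → SubEdges s₂ (nl s) l′ Es →
                        Preserves s (addE s₂ Es)
  iteration-preserves {l′} {s} {Cs} {s₂} I Cs-free steps sub =
    initL-preserves s l′ Cs I Cs-free ▷ λ I₁ _ →
    Star-preserving lstep-preserves I₁ steps ▷ λ I₂ _ →
    subEdges-preserves s₂ I₂ sub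

  search-preserves : ∀ {l′ s Cs s′ r} → Invariant s → All W⁺Free Cs → Search l′ s Cs s′ r → Preserves s s′
  search-preserves I Cs-free (found steps _ sub _)   = iteration-preserves I Cs-free steps sub
  search-preserves I Cs-free (empty steps _ sub _ _) = iteration-preserves I Cs-free steps sub
  search-preserves {s = s} I Cs-free (again {s₂ = s₂} steps _ sub _ _ rest) =
    iteration-preserves I Cs-free steps sub ▷ λ I′ _ →
    search-preserves I′ (cprime-w⁺-free (nl s) (V s₂) (now-w⁺-free ∘ vertex I′)) rest

  EventualityAt : St n → ℕ × Disj n × ALit n → Set
  EventualityAt s (kc , Q , l′) = At (V s) kc (vx (ev Q l′) main inC)

  cstep-preserves : ∀ {kc Q l′ k s s′} → Invariant s → EventualityAt s (kc , Q , l′) →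
                    CStep kc Q l′ k s s′ → Preserves s s′
  cstep-preserves {kc} {Q} {l′} {s = s} I a-kc (c1 {i} {P} (vx _ _ _ , aᵢ , refl , refl) _) =
    addV-preserves s v′ ps I (vertex-inv (λ ()) (λ { refl () }) J) incoming
    where
    v′ = vx (conc1C P Q l′) main conc1
    ps = i ∷ kc ∷ []
    Q-wfree : All WFreeL Q
    Q-wfree = All.lookup C-wfree (ev∈C (vertex I a-kc) refl)
    P-free : W⁺Free P
    P-free = now-w⁺-free (vertex I aᵢ) refl tt
    J : Justified (Grounded (addV s v′ ps) (new s)) (conc1C P Q l′)
    J = record { w⁺-now  = ⊥-elim ∘ [ P-free , [ All.lookup Q-wfree , w⁺∉⌜ l′ ⌝ ] ∘ ∈-++⁻ Q ] ∘ ∈-++⁻ P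
               ; w⁺-next = λ () }
    incoming : ∀ {q} → q ∈ ps → Passes s (addV s v′ ps) q (new s)
    incoming (here refl)         = via aᵢ λ { (inj₁ m) → addV-marked s v′ ps (inj₁ (∈-++⁺ˡ m)) ; (inj₂ ()) }
    incoming (there (here refl)) = via a-kc λ { (inj₁ m) → ⊥-elim (All.lookup Q-wfree m) ; (inj₂ ()) }
  cstep-preserves {l′ = l′} {s = s} I a-kc (c2 {i} {P} (vx _ _ _ , aᵢ , refl , refl) _) =
    addV-preserves s v′ ps I (vertex-inv (λ ()) (λ { refl _ (here ()) ; refl _ (there ()) }) J) incoming
    where
    v′ = vx (conc2C P l′) main conc2
    ps = i ∷ []
    P-free : W⁺Free P
    P-free = now-w⁺-free (vertex I aᵢ) refl tt
    J : Justified (Grounded (addV s v′ ps) (new s)) (conc2C P l′)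
    J = record { w⁺-now  = λ { (here ()) ; (there ()) }
               ; w⁺-next = ⊥-elim ∘ [ P-free , w⁺∉⌜ l′ ⌝ ] ∘ ∈-++⁻ P }
    incoming : ∀ {q} → q ∈ ps → Passes s (addV s v′ ps) q (new s)
    incoming (here refl) = via aᵢ λ { (inj₁ m) → addV-marked s v′ ps (inj₂ (∈-++⁺ˡ m)) ; (inj₂ ()) }

  concs-preserves : ∀ {kc Q l′ k s s′} → Invariant s → EventualityAt s (kc , Q , l′) →
                    Star (CStep kc Q l′ k) s s′ → Preserves s s′
  concs-preserves I a ε        = I , ⊑-refl
  concs-preserves I a (c ◅ cs) = cstep-preserves I a c ▷ λ I′ X → concs-preserves I′ (⊑-At X a) cs

  found-preserves : ∀ {kc Q l′ k s s₁ s₂ s₃} → Invariant s → EventualityAt s (kc , Q , l′) →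
                    Search l′ s ([] ∷ []) s₁ (just k) → Star (CStep kc Q l′ k) s₁ s₂ → Star MStep s₂ s₃ →
                    Preserves s s₃
  found-preserves I a search concs sat =
    search-preserves I ((λ ()) ∷ []) search ▷ λ I₁ X₁ →
    concs-preserves I₁ (⊑-At X₁ a) concs ▷ λ I₂ _ →
    Star-preserving mstep-preserves I₂ sat

  result : Outcome n → St n
  result (unsat s) = s
  result (fin s)   = s

  forEv-preserves : ∀ {es s out} → Invariant s → All (EventualityAt s) es → ForEv es s out → Preserves s (result out)
  forEv-preserves I []             nil = I , ⊑-refl
  forEv-preserves I (_ ∷ located) (notfound search rest) =
    search-preserves I ((λ ()) ∷ []) search ▷ λ I₁ X₁ →
    forEv-preserves I₁ (All.map (⊑-At X₁) located) rest
  forEv-preserves I (a ∷ _) (found-unsat search concs _ (sat , _) _) = found-preserves I a search concs sat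
  forEv-preserves I (a ∷ located) (found-cont search concs _ (sat , _) _ rest) =
    found-preserves I a search concs sat ▷ λ I₁ X₁ →
    forEv-preserves I₁ (All.map (⊑-At X₁) located) rest

  outer-invariant : ∀ {es s s′} → Outer es s s′ → Invariant s → All (EventualityAt s) es → Invariant s′
  outer-invariant (stop pass)        I located = proj₁ (forEv-preserves I located pass)
  outer-invariant (more pass _ rest) I located with forEv-preserves I located pass
  ... | I′ , X = outer-invariant rest I′ (All.map (⊑-At X) located)

  astep-preserves : Preserving AStep
  astep-preserves {s} I (a1 {k} {P} {l′} (vx _ _ _ , ak , refl , refl) _) =
    addV-preserves s v′ ps I (vertex-inv (λ ()) (λ { refl () }) J) incoming
    where
    v′ = vx (aug1C P l′) main aug1
    ps = k ∷ []
    P-wfree : All WFreeL P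
    P-wfree = All.lookup C-wfree (ev∈C (vertex I ak) refl)
    w⁺-now′ : w⁺ ∈ ⌜ l′ ⌝ ∷ wL l′ ∷ P → Grounded (addV s v′ ps) (new s)
    w⁺-now′ (here ())
    w⁺-now′ (there (here eq)) = addV-grounded s v′ (here refl) (Grounded-eventuality I ak refl (wL-injective eq))
    w⁺-now′ (there (there m)) = ⊥-elim (All.lookup P-wfree m)
    J : Justified (Grounded (addV s v′ ps) (new s)) (aug1C P l′)
    J = record { w⁺-now = w⁺-now′ ; w⁺-next = λ () }
    incoming : ∀ {q} → q ∈ ps → Passes s (addV s v′ ps) q (new s)
    incoming (here refl) = via ak λ { (inj₁ m) → ⊥-elim (All.lookup P-wfree m) ; (inj₂ ()) }
  astep-preserves {s} I (a2 {l = l′} _ _) =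
    addV-preserves s v′ [] I (vertex-inv (λ ()) (λ { refl _ (here ()) ; refl _ (there ()) }) J) (λ ())
    where
    v′ = vx (aug2C l′) main aug2
    J : Justified (Grounded (addV s v′ []) (new s)) (aug2C l′)
    J = record { w⁺-now  = λ { (here ()) ; (there ()) }
               ; w⁺-next = λ { (here ()) ; (there (here eq)) → inj₁ (here (cong neg eq)) ; (there (there ())) } }

  now-wfree : ∀ c → WFree c → All WFreeL (now c)
  now-wfree (init _)   wf       = wf
  now-wfree (glob _ _) (wf , _) = wf
  now-wfree (ev _ _)   wf       = wf

  next-wfree : ∀ c → WFree c → All WFreeL (next c)
  next-wfree (init _)   _        = []
  next-wfree (glob _ _) (_ , wf) = wf
  next-wfree (ev _ _)   _        = []

  initial-invariant : Invariant (st0 C)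
  initial-invariant = record { vertex = vertex₀ ; edge = λ () }
    where
    vertex₀ : ∀ {k v} → At (V (st0 C)) k v → VertexInv (st0 C) k v
    vertex₀ a with At-map⁻ (λ c → vx c main inC) a
    ... | c , c∈C , refl =
      vertex-inv (λ eq → subst (_∈ C) eq c∈C) (NowW⁺Free-wfree c (now-wfree c wf))
                 (Justified-w⁺-free (now-wfree c wf) (next-wfree c wf))
      where
      wf : WFree c
      wf = All.lookup C-wfree c∈C

  evs-located : ∀ k (cs : List (Clause n)) → Segment (λ c → vx c main inC) (V (st0 C)) k cs →
                All (EventualityAt (st0 C)) (evs k cs)
  evs-located k []             seg = []
  evs-located k (ev _ _ ∷ cs)   seg = Segment-head seg ∷ evs-located (suc k) cs (Segment-tail seg)
  evs-located k (init _ ∷ cs)   seg = evs-located (suc k) cs (Segment-tail seg)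
  evs-located k (glob _ _ ∷ cs) seg = evs-located (suc k) cs (Segment-tail seg)

  augmented-preserves : ∀ {s₁ s₂ s₃} → Star MStep (st0 C) s₁ → Star AStep s₁ s₂ → Star MStep s₂ s₃ →
                        Preserves (st0 C) s₃
  augmented-preserves sat₁ augs sat₂ =
    Star-preserving mstep-preserves initial-invariant sat₁ ▷ λ I₁ _ →
    Star-preserving astep-preserves I₁ augs ▷ λ I₂ _ →
    Star-preserving mstep-preserves I₂ sat₂

  run-invariant : ∀ {s} → RunUnsat C s → Invariant s
  run-invariant (r0 _)                                     = initial-invariant
  run-invariant (r1 _ (sat , _) _)                         = proj₁ (Star-preserving mstep-preserves initial-invariant sat)
  run-invariant (r2 _ (sat₁ , _) _ augs _ (sat₂ , _) _)   = proj₁ (augmented-preserves sat₁ augs sat₂)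
  run-invariant (r3 _ (sat₁ , _) _ augs _ (sat₂ , _) _ o) with augmented-preserves sat₁ augs sat₂
  ... | I , X = outer-invariant o I (All.map (⊑-At X) (evs-located 0 C (At-map⁺ (λ c → vx c main inC))))

  Traced-along : ∀ {s u x} → Invariant s → Reaches (E s) u x → Traced s u → Traced s x
  Traced-along I done       t                   = t
  Traced-along I (step e r) (grounded-vertex g) = Traced-along I r (grounded-vertex (Grounded-step e g))
  Traced-along I (step e r) (marked-vertex a m) with edge I e
  ... | via a′ pass with At-functional a a′
  ...   | refl = Traced-along I r (pass m)

  IsBox-unmarked : ∀ c → IsBox c → ¬ Marked c
  IsBox-unmarked (init _)   refl          (inj₁ ())
  IsBox-unmarked (init _)   refl          (inj₂ ())
  IsBox-unmarked (glob _ _) (refl , refl) (inj₁ ())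
  IsBox-unmarked (glob _ _) (refl , refl) (inj₂ ())

  box-grounded : ∀ {s} → RunUnsat C s → ∀ {b vb i vi} → At (V s) b vb → IsBox (label vb) →
                 At (V s) i vi → label vi ≡ aug2C l → Reaches (E s) i b → Grounded s b
  box-grounded run ab box ai lab reach
    with Traced-along (run-invariant run) reach (marked-vertex ai (subst Marked (sym lab) (inj₁ (here refl))))
  ... | grounded-vertex g = g
  ... | marked-vertex a m with At-functional a ab
  ...   | refl = ⊥-elim (IsBox-unmarked _ box m)

lemma1 : ∀ {n : ℕ} (C : List (Clause n)) → All WFree C →
         AllPairs (λ a b → ¬ (a ≈ b)) C →
         (s : St n) → RunUnsat C s →
         ∀ (b : ℕ) (vb : Vertex n) → At (V s) b vb → part vb ≡ main → IsBox (label vb) →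
         ∀ (i : ℕ) (vi : Vertex n) (l : ALit n) → At (V s) i vi →
         rule vi ≡ aug2 → label vi ≡ aug2C l → Reaches (E s) i b →
         ∃ λ j → ∃ λ vj → ∃ λ Q → At (V s) j vj × Reaches (E s) j b ×
           label vj ≡ ev Q l × ev Q l ∈ C
lemma1 C C-wfree _ s run b vb ab _ box i vi l ai _ lab reach
  with Tracing.box-grounded C C-wfree l run ab box ai lab reach
... | Tracing.grounded j vj Q aj r lab′ ev∈C = j , vj , Q , aj , r , lab′ , ev∈C
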